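{- Let $a$ and $d$ be positive integers with $d>1$, and let $n\ge 0$ be an integer. Then there exists an oriented bipartite graph with score set $A=\{a, ad, ad^2,\dots, ad^n\}$.
   Context: An oriented bipartite graph $D(U,V)$ is obtained by assigning a direction to each edge of a simple bipartite graph with parts $U=\{u_1,\dots,u_m\}$ and $V=\{v_1,\dots,v_n\}$. For a vertex $x$, let $d_x^+$ and $d_x^-$ denote its outdegree and indegree. The score of $u\in U$ is $a_u=n+d_u^+-d_u^-$ and the score of $v\in V$ is $b_v=m+d_v^+-d_v^-$. The score set of $D(U,V)$ is the set of distinct scores of all its vertices. -}

module Defs where

open import Data.Nat using (ℕ; zero; suc)
open import Data.Fin using (Fin)
open import Data.Integer using (ℤ; +_; _+_; _-_)
open import Data.Product using (∃-syntax; _×_)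
open import Data.Sum using (_⊎_)
open import Relation.Binary.PropositionalEquality using (_≡_)

-- Orientation of the (potential) edge between u_i and v_j:
--   noEdge : no edge between u_i and v_j
--   uv     : edge directed u_i → v_j
--   vu     : edge directed v_j → u_i
data Orientation : Set where
  noEdge uv vu : Orientation

OBG : ℕ → ℕ → Set
OBG m n = Fin m → Fin n → Orientation

count : ∀ {k} → (Fin k → Orientation) → Orientation → ℕ
count {zero}  f o = 0
count {suc k} f o = step (f Fin.zero) o Data.Nat.+ count (λ i → f (Fin.suc i)) o
  where
  step : Orientation → Orientation → ℕ
  step noEdge noEdge = 1
  step uv uv = 1
  step vu vu = 1
  step _ _ = 0
  import Data.Nat
  import Data.Fin as Fin

scoreU : ∀ {m n} → OBG m n → Fin m → ℤ
scoreU {m} {n} D i = (+ n + + count (D i) uv) - + count (D i) vu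

scoreV : ∀ {m n} → OBG m n → Fin n → ℤ
scoreV {m} {n} D j = (+ m + + count (λ i → D i j) vu) - + count (λ i → D i j) uv

InScoreSet : ∀ {m n} → OBG m n → ℤ → Set
InScoreSet D x = (∃[ i ] scoreU D i ≡ x) ⊎ (∃[ j ] scoreV D j ≡ x)

{-# OPTIONS --safe #-}

-- Extend an oriented bipartite graph with parts of sizes m, n by c new U-vertices and e new
-- V-vertices, each new vertex beating every old vertex of the other part, the new vertices being
-- mutually non-adjacent. Every old vertex gains exactly as many new opponents as new in-arcs, so
-- its score is unchanged, while the new vertices score 2n + e and 2m + c. Choosing c = t − 2m and
-- e = t − 2n therefore adds exactly the score t whenever 2m, 2n ≤ t, and afterwards both parts
-- have at most t vertices. Hence if every target is at least twice the previous one, as a dᵏ is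
-- for d ≥ 2, the scores can be added one at a time, starting from the empty graph.

module Submission where

open import Defs
open import Data.Nat using (ℕ; zero; suc; _+_; _*_; _∸_; _^_; _≤_; _<_; z≤n; z<s; s≤s; s≤s⁻¹; >-nonZero)
open import Data.Nat.Properties
  using (≤-refl; ≤-reflexive; ≤-trans; <-trans; +-assoc; +-identityʳ; +-monoʳ-≤; +-monoˡ-≤;
         *-monoʳ-≤; *-monoˡ-≤; *-mono-≤; m≤m+n; m+[n∸m]≡n; m<n⇒0<n∸m; m≤n⇒m<n∨m≡n;
         m<1+n⇒m<n∨m≡n; m<n⇒m<1+n; m^n>0; *-commutativeSemigroup)
open import Algebra.Properties.CommutativeSemigroup *-commutativeSemigroup using (x∙yz≈y∙xz)
open import Data.Integer as ℤ using (ℤ; +_)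
open import Data.Integer.Tactic.RingSolver using (solve-∀)
import Data.Nat.Tactic.RingSolver as ℕ-Solver
open import Data.Fin using (Fin; zero; suc; _↑ˡ_; _↑ʳ_; splitAt; fromℕ<)
open import Data.Fin.Properties using (splitAt-↑ˡ; splitAt-↑ʳ)
open import Data.Product using (∃; ∃-syntax; _×_; _,_)
import Data.Product as Σ
open import Data.Sum using (_⊎_; inj₁; inj₂)
import Data.Sum as Sum
open import Data.Sum.Function.Propositional using (_⊎-⇔_)
open import Function using (id; const; _∘_)
open import Function.Bundles using (_⇔_; mk⇔)
open import Function.Properties.Equivalence using () renaming (refl to ⇔-refl; trans to ⇔-trans)
open import Relation.Binary.PropositionalEquality
  using (_≡_; _≢_; _≗_; refl; sym; trans; cong; cong₂; subst)
open import Relation.Nullary using (contradiction)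

private
  variable
    k m n : ℕ

split-∃ : ∀ m {n} {P : Fin (m + n) → Set} → ∃ P → (∃[ i ] P (i ↑ˡ n)) ⊎ (∃[ j ] P (m ↑ʳ j))
split-∃ zero          (j , Pj)     = inj₂ (j , Pj)
split-∃ (suc m)       (zero , P0)  = inj₁ (zero , P0)
split-∃ (suc m) {P = P} (suc i , Pi) = Sum.map₁ (Σ.map suc id) (split-∃ m {P = P ∘ suc} (i , Pi))

count-cong : ∀ {f g : Fin k → Orientation} o → f ≗ g → count f o ≡ count g o
count-cong {zero}  o f≗g = refl
count-cong {suc k} o f≗g rewrite f≗g zero = cong (_+_ _) (count-cong o (f≗g ∘ suc))

count-+ : ∀ m {n} (f : Fin (m + n) → Orientation) o →
          count f o ≡ count (f ∘ (_↑ˡ n)) o + count (f ∘ (m ↑ʳ_)) o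
count-+ zero    f o = refl
count-+ (suc m) {n} f o =
  trans (cong (_+_ _) (count-+ m (f ∘ suc) o))
        (sym (+-assoc _ (count (f ∘ suc ∘ (_↑ˡ n)) o) (count (f ∘ suc ∘ (m ↑ʳ_)) o)))

count-const : ∀ k o → count {k} (const o) o ≡ k
count-const zero    o      = refl
count-const (suc k) noEdge = cong suc (count-const k noEdge)
count-const (suc k) uv     = cong suc (count-const k uv)
count-const (suc k) vu     = cong suc (count-const k vu)

count-const-≢ : ∀ k {o o′} → o ≢ o′ → count {k} (const o) o′ ≡ 0
count-const-≢ zero                      o≢o′ = refl
count-const-≢ (suc k) {noEdge} {noEdge} o≢o′ = contradiction refl o≢o′
count-const-≢ (suc k) {noEdge} {uv}     o≢o′ = count-const-≢ k o≢o′
count-const-≢ (suc k) {noEdge} {vu}     o≢o′ = count-const-≢ k o≢o′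
count-const-≢ (suc k) {uv}     {noEdge} o≢o′ = count-const-≢ k o≢o′
count-const-≢ (suc k) {uv}     {uv}     o≢o′ = contradiction refl o≢o′
count-const-≢ (suc k) {uv}     {vu}     o≢o′ = count-const-≢ k o≢o′
count-const-≢ (suc k) {vu}     {noEdge} o≢o′ = count-const-≢ k o≢o′
count-const-≢ (suc k) {vu}     {uv}     o≢o′ = count-const-≢ k o≢o′
count-const-≢ (suc k) {vu}     {vu}     o≢o′ = contradiction refl o≢o′

scoreU-≡ : ∀ (D : OBG m n) i {d⁺ d⁻} → count (D i) uv ≡ d⁺ → count (D i) vu ≡ d⁻ →
           scoreU D i ≡ (+ n ℤ.+ + d⁺) ℤ.- + d⁻
scoreU-≡ D i refl refl = refl

scoreV-≡ : ∀ (D : OBG m n) j {d⁺ d⁻} → count (λ i → D i j) vu ≡ d⁺ → count (λ i → D i j) uv ≡ d⁻ →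
           scoreV D j ≡ (+ m ℤ.+ + d⁺) ℤ.- + d⁻
scoreV-≡ D j refl refl = refl

[n+e+x]-[y+e]≡n+x-y : ∀ n e x y → (n ℤ.+ e ℤ.+ x) ℤ.- (y ℤ.+ e) ≡ (n ℤ.+ x) ℤ.- y
[n+e+x]-[y+e]≡n+x-y = solve-∀

n+e+n≡2n+e : ∀ n e → n + e + n ≡ 2 * n + e
n+e+n≡2n+e = ℕ-Solver.solve-∀

extend : OBG m n → (c e : ℕ) → OBG (m + c) (n + e)
extend {m} {n} D c e i j = block (splitAt m i) (splitAt n j)
  where
  block : Fin m ⊎ Fin c → Fin n ⊎ Fin e → Orientation
  block (inj₁ i) (inj₁ j) = D i j
  block (inj₁ _) (inj₂ _) = vu
  block (inj₂ _) (inj₁ _) = uv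
  block (inj₂ _) (inj₂ _) = noEdge

module _ (D : OBG m n) (c e : ℕ) where

  private
    D⁺ : OBG (m + c) (n + e)
    D⁺ = extend D c e

  extend-↑ˡ-↑ˡ : ∀ i j → D⁺ (i ↑ˡ c) (j ↑ˡ e) ≡ D i j
  extend-↑ˡ-↑ˡ i j rewrite splitAt-↑ˡ m i c | splitAt-↑ˡ n j e = refl

  extend-↑ˡ-↑ʳ : ∀ i j → D⁺ (i ↑ˡ c) (n ↑ʳ j) ≡ vu
  extend-↑ˡ-↑ʳ i j rewrite splitAt-↑ˡ m i c | splitAt-↑ʳ n e j = refl

  extend-↑ʳ-↑ˡ : ∀ i j → D⁺ (m ↑ʳ i) (j ↑ˡ e) ≡ uv
  extend-↑ʳ-↑ˡ i j rewrite splitAt-↑ʳ m c i | splitAt-↑ˡ n j e = refl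

  extend-↑ʳ-↑ʳ : ∀ i j → D⁺ (m ↑ʳ i) (n ↑ʳ j) ≡ noEdge
  extend-↑ʳ-↑ʳ i j rewrite splitAt-↑ʳ m c i | splitAt-↑ʳ n e j = refl

  count-row-↑ˡ : ∀ i o → count (D⁺ (i ↑ˡ c)) o ≡ count (D i) o + count {e} (const vu) o
  count-row-↑ˡ i o = trans (count-+ n (D⁺ (i ↑ˡ c)) o)
                           (cong₂ _+_ (count-cong o (extend-↑ˡ-↑ˡ i)) (count-cong o (extend-↑ˡ-↑ʳ i)))

  count-row-↑ʳ : ∀ i o → count (D⁺ (m ↑ʳ i)) o ≡ count {n} (const uv) o + count {e} (const noEdge) o
  count-row-↑ʳ i o = trans (count-+ n (D⁺ (m ↑ʳ i)) o)
                           (cong₂ _+_ (count-cong o (extend-↑ʳ-↑ˡ i)) (count-cong o (extend-↑ʳ-↑ʳ i)))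

  count-col-↑ˡ : ∀ j o →
                 count (λ i → D⁺ i (j ↑ˡ e)) o ≡ count (λ i → D i j) o + count {c} (const uv) o
  count-col-↑ˡ j o = trans (count-+ m (λ i → D⁺ i (j ↑ˡ e)) o)
                           (cong₂ _+_ (count-cong o (λ i → extend-↑ˡ-↑ˡ i j))
                                      (count-cong o (λ i → extend-↑ʳ-↑ˡ i j)))

  count-col-↑ʳ : ∀ j o →
                 count (λ i → D⁺ i (n ↑ʳ j)) o ≡ count {m} (const vu) o + count {c} (const noEdge) o
  count-col-↑ʳ j o = trans (count-+ m (λ i → D⁺ i (n ↑ʳ j)) o)
                           (cong₂ _+_ (count-cong o (λ i → extend-↑ˡ-↑ʳ i j))
                                      (count-cong o (λ i → extend-↑ʳ-↑ʳ i j)))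

  scoreU-↑ˡ : ∀ i → scoreU D⁺ (i ↑ˡ c) ≡ scoreU D i
  scoreU-↑ˡ i = trans (scoreU-≡ D⁺ (i ↑ˡ c) d⁺ d⁻)
                      ([n+e+x]-[y+e]≡n+x-y (+ n) (+ e) (+ count (D i) uv) (+ count (D i) vu))
    where
    d⁺ : count (D⁺ (i ↑ˡ c)) uv ≡ count (D i) uv
    d⁺ = trans (count-row-↑ˡ i uv) (trans (cong (_+_ _) (count-const-≢ e λ ())) (+-identityʳ _))
    d⁻ : count (D⁺ (i ↑ˡ c)) vu ≡ count (D i) vu + e
    d⁻ = trans (count-row-↑ˡ i vu) (cong (_+_ _) (count-const e vu))

  scoreV-↑ˡ : ∀ j → scoreV D⁺ (j ↑ˡ e) ≡ scoreV D j
  scoreV-↑ˡ j = trans (scoreV-≡ D⁺ (j ↑ˡ e) d⁺ d⁻)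
                      ([n+e+x]-[y+e]≡n+x-y (+ m) (+ c) (+ count (λ i → D i j) vu) (+ count (λ i → D i j) uv))
    where
    d⁺ : count (λ i → D⁺ i (j ↑ˡ e)) vu ≡ count (λ i → D i j) vu
    d⁺ = trans (count-col-↑ˡ j vu) (trans (cong (_+_ _) (count-const-≢ c λ ())) (+-identityʳ _))
    d⁻ : count (λ i → D⁺ i (j ↑ˡ e)) uv ≡ count (λ i → D i j) uv + c
    d⁻ = trans (count-col-↑ˡ j uv) (cong (_+_ _) (count-const c uv))

  scoreU-↑ʳ : ∀ i → scoreU D⁺ (m ↑ʳ i) ≡ + (2 * n + e)
  scoreU-↑ʳ i = trans (scoreU-≡ D⁺ (m ↑ʳ i) d⁺ d⁻) (cong +_ (trans (+-identityʳ _) (n+e+n≡2n+e n e)))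
    where
    d⁺ : count (D⁺ (m ↑ʳ i)) uv ≡ n
    d⁺ = trans (count-row-↑ʳ i uv) (trans (cong₂ _+_ (count-const n uv) (count-const-≢ e λ ())) (+-identityʳ n))
    d⁻ : count (D⁺ (m ↑ʳ i)) vu ≡ 0
    d⁻ = trans (count-row-↑ʳ i vu) (cong₂ _+_ (count-const-≢ n λ ()) (count-const-≢ e λ ()))

  scoreV-↑ʳ : ∀ j → scoreV D⁺ (n ↑ʳ j) ≡ + (2 * m + c)
  scoreV-↑ʳ j = trans (scoreV-≡ D⁺ (n ↑ʳ j) d⁺ d⁻) (cong +_ (trans (+-identityʳ _) (n+e+n≡2n+e m c)))
    where
    d⁺ : count (λ i → D⁺ i (n ↑ʳ j)) vu ≡ m
    d⁺ = trans (count-col-↑ʳ j vu) (trans (cong₂ _+_ (count-const m vu) (count-const-≢ c λ ())) (+-identityʳ m))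
    d⁻ : count (λ i → D⁺ i (n ↑ʳ j)) uv ≡ 0
    d⁻ = trans (count-col-↑ʳ j uv) (cong₂ _+_ (count-const-≢ m λ ()) (count-const-≢ c λ ()))

  inScoreSet-extend : ∀ x → InScoreSet D⁺ x ⇔
                      (InScoreSet D x ⊎ (Fin c × x ≡ + (2 * n + e)) ⊎ (Fin e × x ≡ + (2 * m + c)))
  inScoreSet-extend x = mk⇔ to from
    where
    to : InScoreSet D⁺ x → InScoreSet D x ⊎ (Fin c × x ≡ + (2 * n + e)) ⊎ (Fin e × x ≡ + (2 * m + c))
    to (inj₁ u) with split-∃ m u
    ... | inj₁ (i , sᵢ≡x) = inj₁ (inj₁ (i , trans (sym (scoreU-↑ˡ i)) sᵢ≡x))
    ... | inj₂ (i , sᵢ≡x) = inj₂ (inj₁ (i , trans (sym sᵢ≡x) (scoreU-↑ʳ i)))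
    to (inj₂ v) with split-∃ n v
    ... | inj₁ (j , sⱼ≡x) = inj₁ (inj₂ (j , trans (sym (scoreV-↑ˡ j)) sⱼ≡x))
    ... | inj₂ (j , sⱼ≡x) = inj₂ (inj₂ (j , trans (sym sⱼ≡x) (scoreV-↑ʳ j)))

    from : InScoreSet D x ⊎ (Fin c × x ≡ + (2 * n + e)) ⊎ (Fin e × x ≡ + (2 * m + c)) → InScoreSet D⁺ x
    from (inj₁ (inj₁ (i , sᵢ≡x))) = inj₁ (i ↑ˡ c , trans (scoreU-↑ˡ i) sᵢ≡x)
    from (inj₁ (inj₂ (j , sⱼ≡x))) = inj₂ (j ↑ˡ e , trans (scoreV-↑ˡ j) sⱼ≡x)
    from (inj₂ (inj₁ (i , x≡s)))  = inj₁ (m ↑ʳ i , trans (scoreU-↑ʳ i) (sym x≡s))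
    from (inj₂ (inj₂ (j , x≡s)))  = inj₂ (n ↑ʳ j , trans (scoreV-↑ʳ j) (sym x≡s))

guarded-≡⇔ : ∀ {A B X : Set} {u v t x : X} → (A → u ≡ t) → (B → v ≡ t) → A ⊎ B →
             ((A × x ≡ u) ⊎ (B × x ≡ v)) ⇔ x ≡ t
guarded-≡⇔ u≡t v≡t a⊎b = mk⇔
  Sum.[ (λ (a , x≡u) → trans x≡u (u≡t a)) , (λ (b , x≡v) → trans x≡v (v≡t b)) ]
  (λ x≡t → Sum.map (λ a → a , trans x≡t (sym (u≡t a))) (λ b → b , trans x≡t (sym (v≡t b))) a⊎b)

2*m≤n⇒m+1≤n : ∀ {m n} → 1 ≤ n → 2 * m ≤ n → m + 1 ≤ n
2*m≤n⇒m+1≤n {zero}  1≤n _    = 1≤n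
2*m≤n⇒m+1≤n {suc m} _   2m≤n = ≤-trans (s≤s (+-monoʳ-≤ m (s≤s z≤n))) 2m≤n

2*m+k≡n⇒m+k≤n : ∀ m {k n} → 2 * m + k ≡ n → m + k ≤ n
2*m+k≡n⇒m+k≤n m {k} refl = +-monoˡ-≤ k (m≤m+n m (m + 0))

-- When t = 2n there is no new V-vertex (e = 0), so a single new U-vertex has to realise t.
add-score : (D : OBG m n) (t : ℕ) → 1 ≤ t → 2 * m ≤ t → 2 * n ≤ t →
            ∃[ m′ ] ∃[ n′ ] ∃[ D′ ] (m′ ≤ t × n′ ≤ t ×
              ∀ x → InScoreSet {m′} {n′} D′ x ⇔ (InScoreSet D x ⊎ x ≡ + t))
add-score {m} {n} D t 1≤t 2m≤t 2n≤t with m≤n⇒m<n∨m≡n 2n≤t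
... | inj₂ 2n≡t =
  m + 1 , n + 0 , extend D 1 0 , 2*m≤n⇒m+1≤n 1≤t 2m≤t , 2*m+k≡n⇒m+k≤n n 2n+0≡t ,
  λ x → ⇔-trans (inScoreSet-extend D 1 0 x)
                (⇔-refl ⊎-⇔ guarded-≡⇔ (λ _ → cong +_ 2n+0≡t) (λ ()) (inj₁ zero))
  where
  2n+0≡t : 2 * n + 0 ≡ t
  2n+0≡t = trans (+-identityʳ _) 2n≡t
... | inj₁ 2n<t =
  m + c , n + e , extend D c e , 2*m+k≡n⇒m+k≤n m 2m+c≡t , 2*m+k≡n⇒m+k≤n n 2n+e≡t ,
  λ x → ⇔-trans (inScoreSet-extend D c e x)
                (⇔-refl ⊎-⇔ guarded-≡⇔ (λ _ → cong +_ 2n+e≡t) (λ _ → cong +_ 2m+c≡t)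
                                       (inj₂ (fromℕ< (m<n⇒0<n∸m 2n<t))))
  where
  c e : ℕ
  c = t ∸ 2 * m
  e = t ∸ 2 * n
  2m+c≡t : 2 * m + c ≡ t
  2m+c≡t = m+[n∸m]≡n 2m≤t
  2n+e≡t : 2 * n + e ≡ t
  2n+e≡t = m+[n∸m]≡n 2n≤t

∃<⊎⇔∃<suc : ∀ {P : ℕ → Set} m → ((∃[ k ] (k < m × P k)) ⊎ P m) ⇔ (∃[ k ] (k < suc m × P k))
∃<⊎⇔∃<suc {P} m = mk⇔
  Sum.[ (λ (k , k<m , Pk) → k , m<n⇒m<1+n k<m , Pk) , (λ Pm → m , ≤-refl , Pm) ]
  (λ (k , k<1+m , Pk) →
     Sum.map (λ k<m → k , k<m , Pk) (λ k≡m → subst P k≡m Pk) (m<1+n⇒m<n∨m≡n k<1+m))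

scoreSet-prefix : (T : ℕ → ℕ) → (∀ k → 1 ≤ T k) → (∀ k → 2 * T k ≤ T (suc k)) → ∀ m →
                  ∃[ p ] ∃[ q ] ∃[ D ] (2 * p ≤ T m × 2 * q ≤ T m ×
                    ∀ x → InScoreSet {p} {q} D x ⇔ (∃[ k ] (k < m × x ≡ + T k)))
scoreSet-prefix T positive doubling zero =
  0 , 0 , (λ ()) , z≤n , z≤n , λ x → mk⇔ (λ { (inj₁ (() , _)) ; (inj₂ (() , _)) }) (λ ())
scoreSet-prefix T positive doubling (suc m) =
  let p , q , D , 2p≤ , 2q≤ , scores = scoreSet-prefix T positive doubling m
      p′ , q′ , D′ , p′≤ , q′≤ , scores′ = add-score D (T m) (positive m) 2p≤ 2q≤
  in  p′ , q′ , D′ , double-≤ p′≤ , double-≤ q′≤ ,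
      λ x → ⇔-trans (scores′ x) (⇔-trans (scores x ⊎-⇔ ⇔-refl) (∃<⊎⇔∃<suc m))
  where
  double-≤ : ∀ {r} → r ≤ T m → 2 * r ≤ T (suc m)
  double-≤ r≤ = ≤-trans (*-monoʳ-≤ 2 r≤) (doubling m)

theorem2p3 : (a d n : ℕ) → 1 ≤ a → 1 < d →
    ∃[ p ] ∃[ q ] ∃[ D ]
      ((x : ℤ) → InScoreSet {p} {q} D x ⇔ (∃[ k ] (k ≤ n × x ≡ + (a * d ^ k))))
theorem2p3 a d n 1≤a 1<d =
  let p , q , D , _ , _ , scores = scoreSet-prefix (λ k → a * d ^ k) positive doubling (suc n)
  in  p , q , D , λ x → ⇔-trans (scores x) (mk⇔ (Σ.map₂ (Σ.map₁ s≤s⁻¹)) (Σ.map₂ (Σ.map₁ s≤s)))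
  where
  positive : ∀ k → 1 ≤ a * d ^ k
  positive k = *-mono-≤ 1≤a (m^n>0 d {{>-nonZero (<-trans z<s 1<d)}} k)

  doubling : ∀ k → 2 * (a * d ^ k) ≤ a * d ^ suc k
  doubling k = ≤-trans (*-monoˡ-≤ (a * d ^ k) 1<d) (≤-reflexive (x∙yz≈y∙xz d a (d ^ k)))
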